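{- If $\mathcal{D}_h$ is a sound abstraction of $\mathcal{D}_l$ relative to a refinement mapping $m$, then for any sequence of ground high-level actions $\vec\alpha$ and any high-level situation-suppressed formula $\phi$: $\mathcal{D}_l\cup\mathcal{C}\models(\exists s.\,Do(m(\vec\alpha),S_0,s)\land m(\phi)[s])\supset(\forall s.\,Do(m(\vec\alpha),S_0,s)\supset m(\phi)[s])$.
   Context: Situation calculus setting. Objects are a countably infinite set $\mathcal{N}$ of standard names (unique names and domain closure); no function symbols other than constants; no non-fluent predicates. Situations: $S_0$ and $do(a,s)$; $do([a_1,\dots,a_n],s)$ abbreviates $do(a_n,\dots,do(a_1,s)\dots)$, also written $do(\vec a,s)$. $Poss(a,s)$ means $a$ is executable in $s$; $Executable(s)$ means every action along the history from $S_0$ to $s$ was possible where performed. A basic action theory (BAT) over finitely many action types $\mathcal{A}$ and fluents $\mathcal{F}$ consists of initial-state axioms $\mathcal{D}_{S_0}$, precondition axioms $Poss(A(\vec x),s)\equiv\phi^{Poss}_A(\vec x,s)$, successor state axioms $F(\vec x,do(a,s))\equiv\phi^{ssa}_F(\vec x,a,s)$ (right-hand sides uniform in $s$), unique names/domain closure axioms for actions $\mathcal{D}_{ca}$ and for objects $\mathcal{D}_{coa}$, and foundational axioms $\Sigma$. A situation-suppressed formula omits situation arguments of fluents; $\phi[s]$ restores $s$. ConGolog programs $\delta::=\alpha\mid\varphi?\mid\delta_1;\delta_2\mid\delta_1|\delta_2\mid\pi x.\delta\mid\delta^*\mid\delta_1\|\delta_2$, $nil=True?$; $\mathcal{C}$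 are the axioms: $Trans(\alpha,s,\delta',s')\equiv s'=do(\alpha,s)\land Poss(\alpha,s)\land\delta'=True?$; $Trans(\varphi?,s,\delta',s')\equiv False$; $Trans(\delta_1;\delta_2,s,\delta',s')\equiv\exists\delta_1'(Trans(\delta_1,s,\delta_1',s')\land\delta'=\delta_1';\delta_2)\lor(Final(\delta_1,s)\land Trans(\delta_2,s,\delta',s'))$; $Trans(\delta_1|\delta_2,\cdot)\equiv Trans(\delta_1,\cdot)\lor Trans(\delta_2,\cdot)$; $Trans(\pi x.\delta,s,\delta',s')\equiv\exists x.Trans(\delta,s,\delta',s')$; $Trans(\delta^*,s,\delta',s')\equiv\exists\delta''(Trans(\delta,s,\delta'',s')\land\delta'=\delta'';\delta^*)$; $Trans(\delta_1\|\delta_2,s,\delta',s')\equiv\exists\delta_1'(Trans(\delta_1,s,\delta_1',s')\land\delta'=\delta_1'\|\delta_2)\lor\exists\delta_2'(Trans(\delta_2,s,\delta_2',s')\land\delta'=\delta_1\|\delta_2')$; $Final(\alpha,s)\equiv False$; $Final(\varphi?,s)\equiv\varphi[s]$; $Final(\delta_1;\delta_2,s)\equiv Final(\delta_1,s)\land Final(\delta_2,s)$; $Final(\delta_1|\delta_2,s)\equiv Final(\delta_1,s)\lor Final(\delta_2,s)$; $Final(\pi x.\delta,s)\equiv\exists x.Final(\delta,s)$; $Final(\delta^*,s)\equiv True$; $Final(\delta_1\|\delta_2,s)\equiv Final(\delta_1,s)\land Final(\delta_2,s)$. $Do(\delta,s,s')\doteq\exists\delta'.Trans^*(\delta,s,\delta',s')\land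 Final(\delta',s')$, $Trans^*$ the reflexive transitive closure. $\mathcal{D}_h$ (high-level) and $\mathcal{D}_l$ (low-level) are BATs with action types $\mathcal{A}_h,\mathcal{A}_l$ and fluents $\mathcal{F}_h,\mathcal{F}_l$, sharing only $\mathcal{N}$. A refinement mapping $m$ maps each $A\in\mathcal{A}_h$ to a situation-determined ConGolog program $m(A(\vec x))$ over $\mathcal{D}_l$ with free variables $\vec x$, and each $F\in\mathcal{F}_h$ to a situation-suppressed low-level formula $m(F(\vec x))$; $m(\phi)$ substitutes $m(F(\vec x))$ for fluent atoms; $m(\alpha_1,\dots,\alpha_n)=m(\alpha_1);\dots;m(\alpha_n)$, $m(\epsilon)=nil$. For a model $M_h$ of $\mathcal{D}_h$ and a model $M_l$ of $\mathcal{D}_l\cup\mathcal{C}$: $s_h\simeq_m^{M_h,M_l}s_l$ iff for all $F\in\mathcal{F}_h$ and assignments $v$, $M_h,v[s/s_h]\models F(\vec x,s)$ iff $M_l,v[s/s_l]\models m(F(\vec x))[s]$. A relation $B$ between situation domains is an $m$-bisimulation if each $\langle s_h,s_l\rangle\in B$ satisfies: (1) $s_h\simeq_m^{M_h,M_l}s_l$; (2) for each $A\in\mathcal{A}_h$ and $v$, if some $s_h'$ has $M_h,v[s/s_h,s'/s_h']\models Poss(A(\vec x),s)\land s'=do(A(\vec x),s)$ then some $s_l'$ has $M_l,v[s/s_l,s'/s_l']\models Do(m(A(\vec x)),s,s')$ and $\langle s_h',s_l'\rangle\in B$; (3) conversely, if some $s_l'$ has $M_l,v[s/s_l,s'/s_l']\models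 Do(m(A(\vec x)),s,s')$ then some $s_h'$ has $M_h,v[s/s_h,s'/s_h']\models Poss(A(\vec x),s)\land s'=do(A(\vec x),s)$ and $\langle s_h',s_l'\rangle\in B$. $M_h\sim_m M_l$ iff some $m$-bisimulation contains $\langle S_0^{M_h},S_0^{M_l}\rangle$. $\mathcal{D}_h$ is a sound abstraction of $\mathcal{D}_l$ relative to $m$ iff for every model $M_l$ of $\mathcal{D}_l\cup\mathcal{C}$ there is a model $M_h$ of $\mathcal{D}_h$ with $M_h\sim_m M_l$. -}

module Defs where

-- Semantic conventions:
--  * objects = standard names = ℕ (unique names + domain closure for objects)
--  * actions = A(n⃗) for an action type A and names n⃗ (unique names + domain
--    closure for actions)
--  * situations = finite action sequences, do(a,s) = a ∷ s, S0 = []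
--    (the foundational axioms Σ, being second order, fix this domain)
--  * the ConGolog axioms C determine Trans / Final; they are given here as
--    inductive relations, with π handled by substitution of a name.

open import Data.Nat using (ℕ; zero; suc; _≡ᵇ_)
open import Data.Bool using (Bool; true; false; if_then_else_)
open import Data.Fin using (Fin)
open import Data.Vec using (Vec; []; _∷_)
import Data.Vec as Vec
open import Data.List using (List; []; _∷_)
open import Data.Product using (Σ; _×_; _,_)
open import Data.Sum using (_⊎_)
open import Data.Unit using (⊤; tt)
open import Data.Empty using (⊥)
open import Function.Bundles using (_⇔_)
open import Relation.Binary.PropositionalEquality using (_≡_)

-- A signature: finitely many action types and fluents, each with an arity
-- (number of object arguments; fluents additionally take a situation).
record Sig : Set where
  field
    nA  : ℕ
    aAr : Fin nA → ℕ
    nF  : ℕ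
    fAr : Fin nF → ℕ
open Sig public

Act : Sig → Set
Act S = Σ (Fin (nA S)) (λ A → Vec ℕ (aAr S A))

Sit : Sig → Set
Sit S = List (Act S)

S₀ : ∀ {S} → Sit S
S₀ = []

doₛ : ∀ {S} → Act S → Sit S → Sit S
doₛ a s = a ∷ s

FlI : Sig → Set₁
FlI S = (F : Fin (nF S)) → Vec ℕ (fAr S F) → Set

data Term : Set where
  var : ℕ → Term
  nm  : ℕ → Term

data ATerm (S : Sig) : Set where
  avar : ℕ → ATerm S
  act  : (A : Fin (nA S)) → Vec Term (aAr S A) → ATerm S

-- index b = true : action terms / action quantifiers allowed
-- index b = false : only object terms (used for high-level formulas φ,
--                   which are mapped by m fluent-wise)
data Fm (S : Sig) : Bool → Set where
  flu  : ∀ {b} (F : Fin (nF S)) → Vec Term (fAr S F) → Fm S b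
  eqO  : ∀ {b} → Term → Term → Fm S b
  eqA  : ATerm S → ATerm S → Fm S true
  ⊤ᶠ   : ∀ {b} → Fm S b
  ⊥ᶠ   : ∀ {b} → Fm S b
  ¬ᶠ_  : ∀ {b} → Fm S b → Fm S b
  _∧ᶠ_ : ∀ {b} → Fm S b → Fm S b → Fm S b
  _∨ᶠ_ : ∀ {b} → Fm S b → Fm S b → Fm S b
  _⇒ᶠ_ : ∀ {b} → Fm S b → Fm S b → Fm S b
  ∀ᵒ   : ∀ {b} → ℕ → Fm S b → Fm S b
  ∃ᵒ   : ∀ {b} → ℕ → Fm S b → Fm S b
  ∀ᵃ   : ℕ → Fm S true → Fm S true
  ∃ᵃ   : ℕ → Fm S true → Fm S true

OEnv : Set
OEnv = ℕ → ℕ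

AEnv : Sig → Bool → Set
AEnv S true  = ℕ → Act S
AEnv S false = ⊤

updO : OEnv → ℕ → ℕ → OEnv
updO ρ x n y = if x ≡ᵇ y then n else ρ y

updA : ∀ {S} → (ℕ → Act S) → ℕ → Act S → ℕ → Act S
updA η x a y = if x ≡ᵇ y then a else η y

args : ∀ {k} → Vec ℕ k → OEnv → OEnv
args []       ρ i       = ρ i
args (v ∷ vs) ρ zero    = v
args (v ∷ vs) ρ (suc i) = args vs (λ j → ρ (suc j)) i

evT : OEnv → Term → ℕ
evT ρ (var i) = ρ i
evT ρ (nm n)  = n

evA : ∀ {S} → OEnv → (ℕ → Act S) → ATerm S → Act S
evA ρ η (avar i)  = η i
evA ρ η (act A ts) = A , Vec.map (evT ρ) ts

⟦_⟧ : ∀ {S b} → Fm S b → FlI S → OEnv → AEnv S b → Set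
⟦ flu F ts ⟧ I ρ η = I F (Vec.map (evT ρ) ts)
⟦ eqO t u  ⟧ I ρ η = evT ρ t ≡ evT ρ u
⟦ eqA t u  ⟧ I ρ η = evA ρ η t ≡ evA ρ η u
⟦ ⊤ᶠ       ⟧ I ρ η = ⊤
⟦ ⊥ᶠ       ⟧ I ρ η = ⊥
⟦ ¬ᶠ φ     ⟧ I ρ η = ⟦ φ ⟧ I ρ η → ⊥
⟦ φ ∧ᶠ ψ   ⟧ I ρ η = ⟦ φ ⟧ I ρ η × ⟦ ψ ⟧ I ρ η
⟦ φ ∨ᶠ ψ   ⟧ I ρ η = ⟦ φ ⟧ I ρ η ⊎ ⟦ ψ ⟧ I ρ η
⟦ φ ⇒ᶠ ψ   ⟧ I ρ η = ⟦ φ ⟧ I ρ η → ⟦ ψ ⟧ I ρ η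
⟦ ∀ᵒ x φ   ⟧ I ρ η = (n : ℕ) → ⟦ φ ⟧ I (updO ρ x n) η
⟦ ∃ᵒ x φ   ⟧ I ρ η = Σ ℕ (λ n → ⟦ φ ⟧ I (updO ρ x n) η)
⟦_⟧ {S} (∀ᵃ x φ) I ρ η = (a : Act S) → ⟦_⟧ {S} {true} φ I ρ (updA {S} η x a)
⟦_⟧ {S} (∃ᵃ x φ) I ρ η = Σ (Act S) (λ a → ⟦_⟧ {S} {true} φ I ρ (updA {S} η x a))

-- * init : the set of sentences 𝒟_S0 (situation-suppressed, about S0)
-- * pre A : φ^Poss_A, free object variables 0 … arity-1 standing for x⃗
-- * ssa F : φ^ssa_F, free object variables 0 … arity-1 for x⃗,
--           action variable 0 standing for a
record BAT (S : Sig) : Set₁ where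
  field
    init : Fm S true → Set
    pre  : Fin (nA S) → Fm S true
    ssa  : Fin (nF S) → Fm S true
open BAT public

-- a model of 𝒟 (including Σ, 𝒟_ca, 𝒟_coa, which fix the domains above)
record Model {S : Sig} (D : BAT S) : Set₁ where
  field
    holds : Sit S → FlI S
    Poss  : Act S → Sit S → Set
    init-ok : ∀ (φ : Fm S true) → init D φ → ∀ (ρ : OEnv) (η : ℕ → Act S) → ⟦_⟧ {S} {true} φ (holds (S₀ {S})) ρ η
    pre-ok  : ∀ A (vs : Vec ℕ (aAr S A)) (s : Sit S) (ρ : OEnv) (η : ℕ → Act S) →
              Poss (A , vs) s ⇔ ⟦ pre D A ⟧ (holds s) (args vs ρ) η
    ssa-ok  : ∀ F (vs : Vec ℕ (fAr S F)) (a : Act S) (s : Sit S) (ρ : OEnv) (η : ℕ → Act S) →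
              holds (doₛ {S} a s) F vs ⇔ ⟦_⟧ {S} {true} (ssa D F) (holds s) (args vs ρ) (updA {S} η 0 a)
open Model public

Executable : ∀ {S} {D : BAT S} → Model D → Sit S → Set
Executable M []      = ⊤
Executable M (a ∷ s) = Executable M s × Poss M a s

data Prog (S : Sig) : Set where
  act  : ATerm S → Prog S
  test : Fm S true → Prog S
  _；_ : Prog S → Prog S → Prog S
  _∣_  : Prog S → Prog S → Prog S
  π    : ℕ → Prog S → Prog S
  _*   : Prog S → Prog S
  _∥_  : Prog S → Prog S → Prog S

nil : ∀ {S} → Prog S
nil = test ⊤ᶠ

substT : ℕ → ℕ → Term → Term
substT x n (var y) = if x ≡ᵇ y then nm n else var y
substT x n (nm m)  = nm m

substA : ∀ {S} → ℕ → ℕ → ATerm S → ATerm S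
substA x n (avar i)   = avar i
substA x n (act A ts) = act A (Vec.map (substT x n) ts)

substF : ∀ {S b} → ℕ → ℕ → Fm S b → Fm S b
substF x n (flu F ts) = flu F (Vec.map (substT x n) ts)
substF x n (eqO t u)  = eqO (substT x n t) (substT x n u)
substF x n (eqA t u)  = eqA (substA x n t) (substA x n u)
substF x n ⊤ᶠ         = ⊤ᶠ
substF x n ⊥ᶠ         = ⊥ᶠ
substF x n (¬ᶠ φ)     = ¬ᶠ substF x n φ
substF x n (φ ∧ᶠ ψ)   = substF x n φ ∧ᶠ substF x n ψ
substF x n (φ ∨ᶠ ψ)   = substF x n φ ∨ᶠ substF x n ψ
substF x n (φ ⇒ᶠ ψ)   = substF x n φ ⇒ᶠ substF x n ψ
substF x n (∀ᵒ y φ)   = if x ≡ᵇ y then ∀ᵒ y φ else ∀ᵒ y (substF x n φ)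
substF x n (∃ᵒ y φ)   = if x ≡ᵇ y then ∃ᵒ y φ else ∃ᵒ y (substF x n φ)
substF x n (∀ᵃ y φ)   = ∀ᵃ y (substF x n φ)
substF x n (∃ᵃ y φ)   = ∃ᵃ y (substF x n φ)

substP : ∀ {S} → ℕ → ℕ → Prog S → Prog S
substP x n (act α)   = act (substA x n α)
substP x n (test φ)  = test (substF x n φ)
substP x n (d ； e)  = substP x n d ； substP x n e
substP x n (d ∣ e)   = substP x n d ∣ substP x n e
substP x n (π y d)   = if x ≡ᵇ y then π y d else π y (substP x n d)
substP x n (d *)     = substP x n d *
substP x n (d ∥ e)   = substP x n d ∥ substP x n e

instP : ∀ {S k} → Prog S → Vec ℕ k → Prog S
instP d vs = go 0 vs d
  where
  go : ∀ {S k} → ℕ → Vec ℕ k → Prog S → Prog S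
  go i []       d = d
  go i (v ∷ vs) d = go (suc i) vs (substP i v d)

module ConGolog {S : Sig} {D : BAT S} (M : Model D) (ρ : OEnv) (η : ℕ → Act S) where

  data Final : Prog S → Sit S → Set where
    fTest : ∀ {φ s} → ⟦ φ ⟧ (holds M s) ρ η → Final (test φ) s
    fSeq  : ∀ {d e s} → Final d s → Final e s → Final (d ； e) s
    fAlt₁ : ∀ {d e s} → Final d s → Final (d ∣ e) s
    fAlt₂ : ∀ {d e s} → Final e s → Final (d ∣ e) s
    fPi   : ∀ {x d s} (n : ℕ) → Final (substP x n d) s → Final (π x d) s
    fStar : ∀ {d s} → Final (d *) s
    fPar  : ∀ {d e s} → Final d s → Final e s → Final (d ∥ e) s

  data Trans : Prog S → Sit S → Prog S → Sit S → Set where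
    tAct  : ∀ {α s} → Poss M (evA ρ η α) s →
            Trans (act α) s (test ⊤ᶠ) (doₛ {S} (evA ρ η α) s)
    tSeq₁ : ∀ {d e d' s s'} → Trans d s d' s' → Trans (d ； e) s (d' ； e) s'
    tSeq₂ : ∀ {d e e' s s'} → Final d s → Trans e s e' s' → Trans (d ； e) s e' s'
    tAlt₁ : ∀ {d e d' s s'} → Trans d s d' s' → Trans (d ∣ e) s d' s'
    tAlt₂ : ∀ {d e e' s s'} → Trans e s e' s' → Trans (d ∣ e) s e' s'
    tPi   : ∀ {x d d' s s'} (n : ℕ) → Trans (substP x n d) s d' s' →
            Trans (π x d) s d' s'
    tStar : ∀ {d d' s s'} → Trans d s d' s' → Trans (d *) s (d' ； (d *)) s'
    tPar₁ : ∀ {d e d' s s'} → Trans d s d' s' → Trans (d ∥ e) s (d' ∥ e) s'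
    tPar₂ : ∀ {d e e' s s'} → Trans e s e' s' → Trans (d ∥ e) s (d ∥ e') s'

  data Trans* : Prog S → Sit S → Prog S → Sit S → Set where
    refl* : ∀ {d s} → Trans* d s d s
    step* : ∀ {d s d₁ s₁ d₂ s₂} → Trans d s d₁ s₁ → Trans* d₁ s₁ d₂ s₂ →
            Trans* d s d₂ s₂

  Do : Prog S → Sit S → Sit S → Set
  Do d s s' = Σ (Prog S) (λ d' → Trans* d s d' s' × Final d' s')

open ConGolog public

-- m(A(x⃗)) : low-level program, x⃗ = object variables 0 … arity-1
-- m(F(x⃗)) : low-level situation-suppressed formula, x⃗ = variables 0 … arity-1
-- Each m(A(x⃗)) is required to be situation-determined (in every executable
-- situation, for every instantiation of x⃗, in every model of 𝒟_l ∪ 𝒞).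
record Refinement (Sh Sl : Sig) (Dl : BAT Sl) : Set₁ where
  field
    mA : Fin (nA Sh) → Prog Sl
    mF : Fin (nF Sh) → Fm Sl true
    sitDet : ∀ A (vs : Vec ℕ (aAr Sh A)) (M : Model Dl) (ρ : OEnv) (η : ℕ → Act Sl) (s s' : Sit Sl) (d' d'' : Prog Sl) →
             Executable M s →
             Trans* M ρ η (instP (mA A) vs) s d' s' →
             Trans* M ρ η (instP (mA A) vs) s d'' s' → d' ≡ d''
open Refinement public

module _ {Sh Sl : Sig} {Dl : BAT Sl} (m : Refinement Sh Sl Dl) where

  mAct : Act Sh → Prog Sl
  mAct (A , vs) = instP (mA m A) vs

  mSeq : List (Act Sh) → Prog Sl
  mSeq []           = nil
  mSeq (α ∷ [])     = mAct α
  mSeq (α ∷ β ∷ αs) = mAct α ； mSeq (β ∷ αs)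

  -- truth of m(φ)[s] in a low-level model: every fluent atom F(t⃗) of φ is
  -- replaced by m(F(x⃗)) with x⃗ := t⃗
  ⟦m_⟧ : Fm Sh false → Model Dl → Sit Sl → OEnv → (ℕ → Act Sl) → Set
  ⟦m φ ⟧ Ml s ρ η = ⟦ φ ⟧ (λ F vs → ⟦ mF m F ⟧ (holds Ml s) (args vs ρ) η) ρ tt

  module _ {Dh : BAT Sh} (Mh : Model Dh) (Ml : Model Dl) where

    _≃_ : Sit Sh → Sit Sl → Set
    sh ≃ sl = ∀ F (vs : Vec ℕ (fAr Sh F)) (ρ : OEnv) (η : ℕ → Act Sl) →
              holds Mh sh F vs ⇔ ⟦ mF m F ⟧ (holds Ml sl) (args vs ρ) η

    IsBisim : (Sit Sh → Sit Sl → Set) → Set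
    IsBisim B = ∀ (sh : Sit Sh) (sl : Sit Sl) → B sh sl →
        (sh ≃ sl)
      × (∀ A (vs : Vec ℕ (aAr Sh A)) (ρ : OEnv) (η : ℕ → Act Sl) →
           Σ (Sit Sh) (λ sh' → Poss Mh (A , vs) sh × sh' ≡ doₛ {Sh} (A , vs) sh) →
           Σ (Sit Sl) (λ sl' → Do Ml ρ η (instP (mA m A) vs) sl sl'
                               × B (doₛ {Sh} (A , vs) sh) sl'))
      × (∀ A (vs : Vec ℕ (aAr Sh A)) (ρ : OEnv) (η : ℕ → Act Sl) (sl' : Sit Sl) → Do Ml ρ η (instP (mA m A) vs) sl sl' →
           Σ (Sit Sh) (λ sh' → Poss Mh (A , vs) sh × sh' ≡ doₛ {Sh} (A , vs) sh
                               × B sh' sl'))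

    Bisimilar : Set₁
    Bisimilar = Σ (Sit Sh → Sit Sl → Set) (λ B → IsBisim B × B (S₀ {Sh}) (S₀ {Sl}))

  SoundAbstraction : BAT Sh → Set₁
  SoundAbstraction Dh = (Ml : Model Dl) → Σ (Model Dh) (λ Mh → Bisimilar Mh Ml)

-- Condition (3) of an m-bisimulation, applied along m(α₁);…;m(αₙ), relates every
-- situation reached by an execution of m(α⃗) from S₀ to the single high-level
-- situation do(α⃗,S₀); by condition (1) each such situation satisfies m(φ) iff
-- do(α⃗,S₀) satisfies φ.
module Submission where

open import Defs
open import Data.Nat using (ℕ)
open import Data.List using (List; []; _∷_)
open import Data.Bool using (false)
open import Data.Product using (Σ; _×_; _,_; proj₁; proj₂)
open import Data.Product.Function.NonDependent.Propositional using (_×-⇔_)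
open import Data.Product.Function.Dependent.Propositional using (Σ-⇔)
open import Data.Sum.Function.Propositional using (_⊎-⇔_)
open import Function.Bundles using (_⇔_; mk⇔; Equivalence)
open import Function.Construct.Identity using (⇔-id; ↠-id)
open import Function.Construct.Symmetry using (⇔-sym)
open import Function.Related.TypeIsomorphisms using (→-cong-⇔; ¬-cong-⇔)
open import Relation.Binary.PropositionalEquality using (_≡_; refl)

open Equivalence using (to; from)

Π-cong-⇔ : {A : Set} {P Q : A → Set} → (∀ a → P a ⇔ Q a) → ((a : A) → P a) ⇔ ((a : A) → Q a)
Π-cong-⇔ P⇔Q = mk⇔ (λ f a → to (P⇔Q a) (f a)) (λ g a → from (P⇔Q a) (g a))

⟦⟧-cong : ∀ {S b} {I J : FlI S} → (∀ F vs → I F vs ⇔ J F vs) →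
          (φ : Fm S b) (ρ : OEnv) (η : AEnv S b) → ⟦ φ ⟧ I ρ η ⇔ ⟦ φ ⟧ J ρ η
⟦⟧-cong I⇔J (flu F ts) ρ η = I⇔J F _
⟦⟧-cong I⇔J (eqO t u)  ρ η = ⇔-id _
⟦⟧-cong I⇔J (eqA t u)  ρ η = ⇔-id _
⟦⟧-cong I⇔J ⊤ᶠ         ρ η = ⇔-id _
⟦⟧-cong I⇔J ⊥ᶠ         ρ η = ⇔-id _
⟦⟧-cong I⇔J (¬ᶠ φ)     ρ η = ¬-cong-⇔ (⟦⟧-cong I⇔J φ ρ η)
⟦⟧-cong I⇔J (φ ∧ᶠ ψ)   ρ η = ⟦⟧-cong I⇔J φ ρ η ×-⇔ ⟦⟧-cong I⇔J ψ ρ η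
⟦⟧-cong I⇔J (φ ∨ᶠ ψ)   ρ η = ⟦⟧-cong I⇔J φ ρ η ⊎-⇔ ⟦⟧-cong I⇔J ψ ρ η
⟦⟧-cong I⇔J (φ ⇒ᶠ ψ)   ρ η = →-cong-⇔ (⟦⟧-cong I⇔J φ ρ η) (⟦⟧-cong I⇔J ψ ρ η)
⟦⟧-cong I⇔J (∀ᵒ x φ)   ρ η = Π-cong-⇔ (λ n → ⟦⟧-cong I⇔J φ (updO ρ x n) η)
⟦⟧-cong I⇔J (∃ᵒ x φ)   ρ η = Σ-⇔ (↠-id _) (λ {n} → ⟦⟧-cong I⇔J φ (updO ρ x n) η)
⟦⟧-cong {S} I⇔J (∀ᵃ x φ) ρ η = Π-cong-⇔ (λ a → ⟦⟧-cong I⇔J φ ρ (updA {S} η x a))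
⟦⟧-cong {S} I⇔J (∃ᵃ x φ) ρ η = Σ-⇔ (↠-id _) (λ {a} → ⟦⟧-cong I⇔J φ ρ (updA {S} η x a))

module _ {S : Sig} {D : BAT S} (M : Model D) (ρ : OEnv) (η : ℕ → Act S) where

  Do-；-split : ∀ {d e s s'} → Do M ρ η (d ； e) s s' →
               Σ (Sit S) (λ s'' → Do M ρ η d s s'' × Do M ρ η e s'' s')
  Do-；-split (_ , refl* , fSeq fd fe)       = _ , (_ , refl* , fd) , (_ , refl* , fe)
  Do-；-split (_ , step* (tSeq₁ t) r , f) with Do-；-split (_ , r , f)
  ... | s'' , (d' , r' , f') , e-run     = s'' , (d' , step* t r' , f') , e-run
  Do-；-split (_ , step* (tSeq₂ fd t) r , f) = _ , (_ , refl* , fd) , (_ , step* t r , f)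

  Do-nil : ∀ {s s'} → Do M ρ η nil s s' → s' ≡ s
  Do-nil (_ , refl* , _)       = refl
  Do-nil (_ , step* () _ , _)

doₛ* : ∀ {S} → List (Act S) → Sit S → Sit S
doₛ* []       s = s
doₛ* {S} (a ∷ as) s = doₛ* {S} as (doₛ {S} a s)

module _ {Sh Sl : Sig} {Dh : BAT Sh} {Dl : BAT Sl} (m : Refinement Sh Sl Dl)
         (Mh : Model Dh) (Ml : Model Dl) (ρ : OEnv) (η : ℕ → Act Sl) where

  ≃⇒⟦m⟧⇔⟦⟧ : ∀ {sh sl} → _≃_ m Mh Ml sh sl →
             (φ : Fm Sh false) → ⟦m_⟧ m φ Ml sl ρ η ⇔ ⟦ φ ⟧ (holds Mh sh) ρ _
  ≃⇒⟦m⟧⇔⟦⟧ sh≃sl φ = ⟦⟧-cong (λ F vs → ⇔-sym (sh≃sl F vs ρ η)) φ ρ _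

  module _ {B : Sit Sh → Sit Sl → Set} (isB : IsBisim m Mh Ml B) where

    IsBisim-Do-mAct : ∀ α {sh sl sl'} → B sh sl → Do Ml ρ η (mAct m α) sl sl' →
                      B (doₛ {Sh} α sh) sl'
    IsBisim-Do-mAct (A , vs) {sh} {sl} {sl'} Bshsl run
      with proj₂ (proj₂ (isB sh sl Bshsl)) A vs ρ η sl' run
    ... | _ , _ , refl , Bsh'sl' = Bsh'sl'

    IsBisim-Do-mSeq : ∀ αs {sh sl sl'} → B sh sl → Do Ml ρ η (mSeq m αs) sl sl' →
                      B (doₛ* {Sh} αs sh) sl'
    IsBisim-Do-mSeq []           Bshsl run rewrite Do-nil Ml ρ η run = Bshsl
    IsBisim-Do-mSeq (α ∷ [])     Bshsl run = IsBisim-Do-mAct α Bshsl run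
    IsBisim-Do-mSeq (α ∷ β ∷ αs) Bshsl run =
      let _ , run-α , run-rest = Do-；-split Ml ρ η run
      in IsBisim-Do-mSeq (β ∷ αs) (IsBisim-Do-mAct α Bshsl run-α) run-rest

corollary3 : ∀ {Sh Sl : Sig} (Dh : BAT Sh) (Dl : BAT Sl) (m : Refinement Sh Sl Dl) →
    SoundAbstraction m Dh →
    (αs : List (Act Sh)) (φ : Fm Sh false) (Ml : Model Dl) (ρ : OEnv) (η : ℕ → Act Sl) →
    Σ (Sit Sl) (λ s → Do Ml ρ η (mSeq m αs) (S₀ {Sl}) s × ⟦m_⟧ m φ Ml s ρ η) →
    (s : Sit Sl) → Do Ml ρ η (mSeq m αs) (S₀ {Sl}) s → ⟦m_⟧ m φ Ml s ρ η
corollary3 {Sh} {Sl} Dh Dl m sound αs φ Ml ρ η (s₁ , run₁ , φ-at-s₁) s run with sound Ml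
... | Mh , B , isB , B-S₀ = from (mφ⇔φ run) (to (mφ⇔φ run₁) φ-at-s₁)
  where
  mφ⇔φ : ∀ {s} → Do Ml ρ η (mSeq m αs) (S₀ {Sl}) s →
         ⟦m_⟧ m φ Ml s ρ η ⇔ ⟦ φ ⟧ (holds Mh (doₛ* αs (S₀ {Sh}))) ρ _
  mφ⇔φ run = ≃⇒⟦m⟧⇔⟦⟧ m Mh Ml ρ η (proj₁ (isB _ _ (IsBisim-Do-mSeq m Mh Ml ρ η isB αs B-S₀ run))) φ
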